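{- For every integer $e\ge3$, $\nu_2\bigl(f(2^e-1)\bigr)\ge2e$, where $f(n)=\sum_{k=0}^n\binom nk^{ -1}$.
   Context: $\nu_2$ denotes the exponent of $2$ in a rational number (with $\nu_2(0)=\infty$). -}

module Defs where

open import Data.Nat as ℕ using (ℕ; zero; suc; _≤_; _^_)
open import Data.Nat.Combinatorics using (_C_)
open import Data.Nat.Divisibility using (_∣_)
open import Data.Integer as ℤ using (ℤ; +_)
open import Data.Integer.Divisibility as ℤD using ()
open import Data.Rational as ℚ using (ℚ; 0ℚ; _+_; _/_)
open import Data.Product using (Σ; _×_)
open import Data.Sum using (_⊎_)
open import Relation.Binary.PropositionalEquality using (_≡_)
open import Relation.Nullary using (¬_)

-- reciprocal of a natural number as a rational (only used on nonzero arguments;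
-- the value at 0 is an irrelevant convention)
inv : ℕ → ℚ
inv zero    = 0ℚ
inv (suc m) = (+ 1) / suc m

sumTo : ℕ → (ℕ → ℚ) → ℚ
sumTo zero    g = g 0
sumTo (suc m) g = sumTo m g + g (suc m)

f : ℕ → ℚ
f n = sumTo n (λ k → inv (n C k))

OddNat : ℕ → Set
OddNat b = ¬ (2 ∣ b)

OddInt : ℤ → Set
OddInt a = ¬ (ℤ.ℤ.pos 2 ℤD.∣ a)

-- ν₂ as a relation: ν₂(q) = k (k ∈ ℕ) iff q = 2^k · a / b with a, b odd (b > 0 written as suc b).
-- ν₂(q) ≥ m  (m ∈ ℕ) iff q = 0 (ν₂ = ∞) or ν₂(q) = k for some k ≥ m.
ν₂≥ : ℚ → ℕ → Set
ν₂≥ q m = (q ≡ 0ℚ) ⊎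
  Σ ℕ λ k → Σ ℤ λ a → Σ ℕ λ b →
    m ≤ k × OddInt a × OddNat (suc b) ×
    q ≡ ((+ (2 ^ k)) ℤ.* a) / suc b

{-# OPTIONS --safe #-}
-- Put N = 2^e. Summing the reciprocal Pascal identity
-- (n+2)/C(n,k) = (n+1)(1/C(n+1,k) + 1/C(n+1,k+1)) gives 2(n+1) f(n+1) = (n+2) f(n) + 2(n+1),
-- whence the closed form 2^(n+1) f(n) = (n+1) H(n+1) with H(M) = Σ_{k=1}^{M} 2^k/k.
-- At n = N - 1 it reduces the claim to ν₂(H(N)) ≥ N + e. All binomials C(2^m - 1, k) are odd, hence ν₂(f(2N - 1)) ≥ 0
-- and ν₂(H(2N)) ≥ 2N - e - 1 ≥ N + e. Moreover
-- H(2N) - (1 + 2^N) H(N) = - Σ_{J=1}^{N} 2^(J+N) N / (J (J+N)),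
-- and every term has ν₂ ≥ N + e because ν₂(J (J+N)) ≤ J. As 1 + 2^N is odd,
-- ν₂(H(N)) ≥ N + e follows. Both estimates use e ≥ 3 in the form 2e + 1 ≤ N.
module Submission where

open import Defs

module Parity where
  open import Data.Nat
  open import Data.Nat.Properties
  open import Data.Nat.Divisibility
  open import Data.Nat.Induction using (<-rec)
  open import Data.Nat.Primality using (prime?; euclidsLemma)
  open import Data.Product using (∃; ∃₂; _×_; _,_)
  open import Data.Sum using (inj₁; inj₂)
  open import Relation.Nullary using (yes; no; contradiction)
  open import Relation.Nullary.Decidable using (from-yes)
  open import Relation.Binary.PropositionalEquality
  open import Algebra.Properties.CommutativeSemigroup *-commutativeSemigroup using (interchange)

  odd-* : ∀ {m n} → OddNat m → OddNat n → OddNat (m * n)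
  odd-* {m} {n} odd-m odd-n 2∣mn with euclidsLemma m n (from-yes (prime? 2)) 2∣mn
  ... | inj₁ 2∣m = odd-m 2∣m
  ... | inj₂ 2∣n = odd-n 2∣n

  odd-*⇒oddʳ : ∀ m {n} → OddNat (m * n) → OddNat n
  odd-*⇒oddʳ m odd-mn 2∣n = odd-mn (∣-trans 2∣n (n∣m*n m))

  odd-1 : OddNat 1
  odd-1 2∣1 with ∣⇒≤ 2∣1
  ... | s≤s ()

  odd-2*+ : ∀ c {u} → OddNat u → OddNat (2 * c + u)
  odd-2*+ c odd-u 2∣2c+u = odd-u (∣m+n∣m⇒∣n 2∣2c+u (m∣m*n c))

  odd-2*∸ : ∀ c {u} → u ≤ 2 * c → OddNat u → OddNat (2 * c ∸ u)
  odd-2*∸ c {u} u≤2c odd-u 2∣2c∸u =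
    odd-u (∣m+n∣m⇒∣n (subst (2 ∣_) (sym (m∸n+n≡m u≤2c)) (m∣m*n c)) 2∣2c∸u)

  odd-1+2* : ∀ c → OddNat (1 + 2 * c)
  odd-1+2* c = subst OddNat (+-comm (2 * c) 1) (odd-2*+ c odd-1)

  odd⇒>0 : ∀ {u} → OddNat u → u > 0
  odd⇒>0 {zero}  odd-0 = contradiction (divides 0 refl) odd-0
  odd⇒>0 {suc u} _     = s≤s z≤n

  odd-part : ∀ j → j > 0 → ∃₂ λ s u → OddNat u × j ≡ 2 ^ s * u
  odd-part = <-rec _ split
    where
    open ≡-Reasoning
    split : ∀ j → (∀ {i} → i < j → i > 0 → ∃₂ λ s u → OddNat u × i ≡ 2 ^ s * u) →
            j > 0 → ∃₂ λ s u → OddNat u × j ≡ 2 ^ s * u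
    split j rec j>0 with 2 ∣? j
    ... | no odd-j = 0 , j , odd-j , sym (+-identityʳ j)
    ... | yes (divides zero refl) = contradiction j>0 (<-irrefl refl)
    ... | yes (divides i@(suc _) refl) with rec (m<m*n i 2 (s≤s (s≤s z≤n))) (s≤s z≤n)
    ...   | s , u , odd-u , i≡2^s*u =
      suc s , u , odd-u , (begin
        i * 2           ≡⟨ *-comm i 2 ⟩
        2 * i           ≡⟨ cong (2 *_) i≡2^s*u ⟩
        2 * (2 ^ s * u) ≡⟨ *-assoc 2 (2 ^ s) u ⟨
        2 ^ suc s * u   ∎)

  n<2^n : ∀ n → n < 2 ^ n
  n<2^n zero    = s≤s z≤n
  n<2^n (suc n) = +-mono-≤ (m^n>0 2 n) (≤-trans (n<2^n n) (m≤m+n (2 ^ n) 0))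

  s+s≤2^s : ∀ s → s + s ≤ 2 ^ s
  s+s≤2^s zero    = z≤n
  s+s≤2^s (suc s) = begin
    suc s + suc s       ≡⟨ cong (suc s +_) (+-identityʳ (suc s)) ⟨
    2 * suc s           ≤⟨ *-monoʳ-≤ 2 (n<2^n s) ⟩
    2 * 2 ^ s           ∎
    where open ≤-Reasoning

  2e+1≤2^e : ∀ e → 3 ≤ e → suc (e + e) ≤ 2 ^ e
  2e+1≤2^e e 3≤e = subst (λ e → suc (e + e) ≤ 2 ^ e) (m+[n∸m]≡n 3≤e) (from3 (e ∸ 3))
    where
    open ≤-Reasoning
    from3 : ∀ d → suc ((3 + d) + (3 + d)) ≤ 2 ^ (3 + d)
    from3 zero    = n≤1+n 7
    from3 (suc d) = begin
      suc ((4 + d) + (4 + d))       ≡⟨ cong suc (+-suc (4 + d) (3 + d)) ⟩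
      2 + suc ((3 + d) + (3 + d))   ≤⟨ +-mono-≤ (≤-trans (s≤s (s≤s z≤n)) (from3 d)) (from3 d) ⟩
      2 ^ (3 + d) + 2 ^ (3 + d)     ≡⟨ cong (2 ^ (3 + d) +_) (+-identityʳ (2 ^ (3 + d))) ⟨
      2 ^ (4 + d)                   ∎

  2^s*odd<2^e⇒s<e : ∀ {s u e} → OddNat u → 2 ^ s * u < 2 ^ e → s < e
  2^s*odd<2^e⇒s<e {s} {u} {e} odd-u 2^s*u<2^e with s <? e
  ... | yes s<e = s<e
  ... | no  s≮e = contradiction 2^s*u<2^e (≤⇒≯ (begin
    2 ^ e     ≤⟨ ^-monoʳ-≤ 2 (≮⇒≥ s≮e) ⟩
    2 ^ s     ≤⟨ m≤m*n (2 ^ s) u {{>-nonZero (odd⇒>0 odd-u)}} ⟩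
    2 ^ s * u ∎))
    where open ≤-Reasoning

  module _ (e s : ℕ) {u} (odd-u : OddNat u) (2^s*u<2^e : 2 ^ s * u < 2 ^ e) where
    private
      r = e ∸ suc s
      c = 2 ^ r
      2^e≡2^s*2c : 2 ^ e ≡ 2 ^ s * (2 * c)
      2^e≡2^s*2c = begin
        2 ^ e               ≡⟨ cong (2 ^_) (m+[n∸m]≡n (2^s*odd<2^e⇒s<e {s} {u} {e} odd-u 2^s*u<2^e)) ⟨
        2 ^ (suc s + r)     ≡⟨ cong (2 ^_) (+-suc s r) ⟨
        2 ^ (s + suc r)     ≡⟨ ^-distribˡ-+-* 2 s (suc r) ⟩
        2 ^ s * (2 * c)     ∎
        where open ≡-Reasoning

    odd-part-2^e+ : ∃ λ w → OddNat w × 2 ^ e + 2 ^ s * u ≡ 2 ^ s * w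
    odd-part-2^e+ = 2 * c + u , odd-2*+ c odd-u , (begin
      2 ^ e + 2 ^ s * u           ≡⟨ cong (_+ 2 ^ s * u) 2^e≡2^s*2c ⟩
      2 ^ s * (2 * c) + 2 ^ s * u ≡⟨ *-distribˡ-+ (2 ^ s) (2 * c) u ⟨
      2 ^ s * (2 * c + u)         ∎)
      where open ≡-Reasoning

    odd-part-2^e∸ : ∃ λ w → OddNat w × 2 ^ e ∸ 2 ^ s * u ≡ 2 ^ s * w
    odd-part-2^e∸ = 2 * c ∸ u , odd-2*∸ c u≤2c odd-u , (begin
      2 ^ e ∸ 2 ^ s * u           ≡⟨ cong (_∸ 2 ^ s * u) 2^e≡2^s*2c ⟩
      2 ^ s * (2 * c) ∸ 2 ^ s * u ≡⟨ *-distribˡ-∸ (2 ^ s) (2 * c) u ⟨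
      2 ^ s * (2 * c ∸ u)         ∎)
      where
      open ≡-Reasoning
      u≤2c : u ≤ 2 * c
      u≤2c = <⇒≤ (*-cancelˡ-< (2 ^ s) u (2 * c) (subst (2 ^ s * u <_) 2^e≡2^s*2c 2^s*u<2^e))

  odd-part-J*[J+2^e] : ∀ e J → 3 ≤ e → J > 0 → J ≤ 2 ^ e →
                       ∃₂ λ t d → OddNat d × t ≤ J × J * (J + 2 ^ e) ≡ 2 ^ t * d
  odd-part-J*[J+2^e] e J 3≤e J>0 J≤2^e with m≤n⇒m<n∨m≡n J≤2^e
  ... | inj₂ refl = e + suc e , 1 , odd-1 , ≤-trans (≤-reflexive (+-suc e e)) (2e+1≤2^e e 3≤e) , (begin
    2 ^ e * (2 ^ e + 2 ^ e)  ≡⟨ cong (λ x → 2 ^ e * (2 ^ e + x)) (+-identityʳ (2 ^ e)) ⟨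
    2 ^ e * 2 ^ suc e        ≡⟨ ^-distribˡ-+-* 2 e (suc e) ⟨
    2 ^ (e + suc e)          ≡⟨ *-identityʳ _ ⟨
    2 ^ (e + suc e) * 1      ∎)
    where open ≡-Reasoning
  ... | inj₁ J<2^e with odd-part J J>0
  ...   | s , u , odd-u , J≡2^s*u with odd-part-2^e+ e s odd-u (subst (_< 2 ^ e) J≡2^s*u J<2^e)
  ...     | w , odd-w , 2^e+J≡2^s*w = s + s , u * w , odd-* odd-u odd-w , s+s≤J , (begin
    J * (J + 2 ^ e)                 ≡⟨ cong (λ x → x * (x + 2 ^ e)) J≡2^s*u ⟩
    2 ^ s * u * (2 ^ s * u + 2 ^ e) ≡⟨ cong (2 ^ s * u *_) (+-comm (2 ^ s * u) (2 ^ e)) ⟩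
    2 ^ s * u * (2 ^ e + 2 ^ s * u) ≡⟨ cong (2 ^ s * u *_) 2^e+J≡2^s*w ⟩
    2 ^ s * u * (2 ^ s * w)         ≡⟨ interchange (2 ^ s) u (2 ^ s) w ⟩
    2 ^ s * 2 ^ s * (u * w)         ≡⟨ cong (_* (u * w)) (^-distribˡ-+-* 2 s s) ⟨
    2 ^ (s + s) * (u * w)           ∎)
    where
    open ≡-Reasoning
    s+s≤J : s + s ≤ J
    s+s≤J = ≤-trans (s+s≤2^s s) (subst (2 ^ s ≤_) (sym J≡2^s*u) (m≤m*n (2 ^ s) u {{>-nonZero (odd⇒>0 odd-u)}}))

module Binomial where
  open import Data.Nat
  open import Data.Nat.Properties
  open import Data.Nat.Combinatorics using (_C_; nCk+nC[k+1]≡[n+1]C[k+1]; nCk≡nC[n∸k]; nC1≡n)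
  open import Data.Product using (_,_)
  open import Relation.Binary.PropositionalEquality
  open Parity

  nCk>0 : ∀ {n k} → k ≤ n → n C k > 0
  nCk>0 {k = zero}          _         = s≤s z≤n
  nCk>0 {suc n} {suc k}     (s≤s k≤n) =
    subst (_> 0) (nCk+nC[k+1]≡[n+1]C[k+1] n k) (≤-trans (nCk>0 k≤n) (m≤m+n _ _))

  [1+k]*[1+n]C[1+k]≡[1+n]*nCk : ∀ n k → suc k * (suc n C suc k) ≡ suc n * (n C k)
  [1+k]*[1+n]C[1+k]≡[1+n]*nCk zero    zero    = refl
  [1+k]*[1+n]C[1+k]≡[1+n]*nCk zero    (suc k) = *-zeroʳ (2 + k)
  [1+k]*[1+n]C[1+k]≡[1+n]*nCk (suc n) zero    = trans (*-identityˡ _) (trans (nC1≡n (2 + n)) (sym (*-identityʳ _)))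
  [1+k]*[1+n]C[1+k]≡[1+n]*nCk (suc n) (suc k) = begin
    (2 + k) * ((2 + n) C (2 + k))      ≡⟨ cong ((2 + k) *_) (nCk+nC[k+1]≡[n+1]C[k+1] (suc n) (suc k)) ⟨
    (2 + k) * (X + Y)                  ≡⟨ *-distribˡ-+ (2 + k) X Y ⟩
    (X + suc k * X) + (2 + k) * Y      ≡⟨ +-assoc X (suc k * X) _ ⟩
    X + (suc k * X + (2 + k) * Y)      ≡⟨ cong₂ (λ a b → X + (a + b)) ([1+k]*[1+n]C[1+k]≡[1+n]*nCk n k)
                                                                    ([1+k]*[1+n]C[1+k]≡[1+n]*nCk n (suc k)) ⟩
    X + (suc n * (n C k) + suc n * (n C suc k)) ≡⟨ cong (X +_) (*-distribˡ-+ (suc n) (n C k) (n C suc k)) ⟨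
    X + suc n * (n C k + n C suc k)    ≡⟨ cong (λ a → X + suc n * a) (nCk+nC[k+1]≡[n+1]C[k+1] n k) ⟩
    (2 + n) * X                        ∎
    where
    open ≡-Reasoning
    X = suc n C suc k
    Y = suc n C (2 + k)

  [1+n∸k]*[1+n]Ck≡[1+n]*nCk : ∀ n k → k ≤ n → (suc n ∸ k) * (suc n C k) ≡ suc n * (n C k)
  [1+n∸k]*[1+n]Ck≡[1+n]*nCk n k k≤n = begin
    (suc n ∸ k) * (suc n C k)               ≡⟨ cong₂ _*_ 1+n∸k≡1+j (nCk≡nC[n∸k] (m≤n⇒m≤1+n k≤n)) ⟩
    suc j * (suc n C (suc n ∸ k))           ≡⟨ cong (λ i → suc j * (suc n C i)) 1+n∸k≡1+j ⟩
    suc j * (suc n C suc j)                 ≡⟨ [1+k]*[1+n]C[1+k]≡[1+n]*nCk n j ⟩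
    suc n * (n C j)                         ≡⟨ cong (suc n *_) (nCk≡nC[n∸k] k≤n) ⟨
    suc n * (n C k)                         ∎
    where
    open ≡-Reasoning
    j = n ∸ k
    1+n∸k≡1+j : suc n ∸ k ≡ suc j
    1+n∸k≡1+j = +-∸-assoc 1 k≤n

  [1+k]*nC[1+k]≡[n∸k]*nCk : ∀ n k → k < n → suc k * (n C suc k) ≡ (n ∸ k) * (n C k)
  [1+k]*nC[1+k]≡[n∸k]*nCk (suc n) k (s≤s k≤n) =
    trans ([1+k]*[1+n]C[1+k]≡[1+n]*nCk n k) (sym ([1+n∸k]*[1+n]Ck≡[1+n]*nCk n k k≤n))

  odd-mersenne-nCk : ∀ e {n k} → suc n ≡ 2 ^ e → k ≤ n → OddNat (n C k)
  odd-mersenne-nCk e {k = zero}  _       _   = odd-1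
  odd-mersenne-nCk e {n} {suc k} 1+n≡2^e k<n with odd-part (suc k) (s≤s z≤n)
  ... | s , u , odd-u , 1+k≡2^s*u with odd-part-2^e∸ e s odd-u (subst₂ _<_ 1+k≡2^s*u 1+n≡2^e (s≤s k<n))
  ...   | w , odd-w , 2^e∸2^s*u≡2^s*w =
    odd-*⇒oddʳ u (subst OddNat (sym u*nC[1+k]≡w*nCk) (odd-* odd-w (odd-mersenne-nCk e 1+n≡2^e (<⇒≤ k<n))))
    where
    open ≡-Reasoning
    u*nC[1+k]≡w*nCk : u * (n C suc k) ≡ w * (n C k)
    u*nC[1+k]≡w*nCk = *-cancelˡ-≡ _ _ (2 ^ s) {{>-nonZero (m^n>0 2 s)}} (begin
      2 ^ s * (u * (n C suc k))   ≡⟨ *-assoc (2 ^ s) u _ ⟨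
      2 ^ s * u * (n C suc k)     ≡⟨ cong (_* (n C suc k)) 1+k≡2^s*u ⟨
      suc k * (n C suc k)         ≡⟨ [1+k]*nC[1+k]≡[n∸k]*nCk n k k<n ⟩
      (suc n ∸ suc k) * (n C k)   ≡⟨ cong (_* (n C k)) (cong₂ _∸_ 1+n≡2^e 1+k≡2^s*u) ⟩
      (2 ^ e ∸ 2 ^ s * u) * (n C k) ≡⟨ cong (_* (n C k)) 2^e∸2^s*u≡2^s*w ⟩
      2 ^ s * w * (n C k)         ≡⟨ *-assoc (2 ^ s) w _ ⟩
      2 ^ s * (w * (n C k))       ∎)

module Embedding where
  open import Level using (0ℓ)
  open import Data.Nat as ℕ using (ℕ; suc; _^_; _<_; s≤s; z≤n)
  import Data.Nat.Properties as ℕ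
  open import Data.Integer as ℤ using (ℤ; +_)
  import Data.Integer.Properties as ℤ
  open import Data.Rational using (ℚ; 0ℚ; 1ℚ; _+_; _*_; _/_; toℚᵘ)
  open import Data.Rational.Properties
    using (_≟_; +-*-commutativeRing; toℚᵘ-injective; toℚᵘ-fromℚᵘ; toℚᵘ-homo-+; toℚᵘ-homo-*;
           *-comm; *-assoc; *-identityˡ; *-1-commutativeMonoid)
  open import Algebra.Bundles using (CommutativeMonoid)
  open import Algebra.Properties.CommutativeSemigroup (CommutativeMonoid.commutativeSemigroup *-1-commutativeMonoid)
  open import Data.Rational.Unnormalised as ℚᵘ using (mkℚᵘ; *≡*)
  import Data.Rational.Unnormalised.Properties as ℚᵘ
  open import Tactic.RingSolver.Core.AlmostCommutativeRing using (AlmostCommutativeRing; fromCommutativeRing)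
  open import Relation.Nullary.Decidable using (dec⇒maybe)
  open import Relation.Binary.PropositionalEquality

  ringℚ : AlmostCommutativeRing 0ℓ 0ℓ
  ringℚ = fromCommutativeRing +-*-commutativeRing (λ x → dec⇒maybe (0ℚ ≟ x))

  ιℤ : ℤ → ℚ
  ιℤ a = a / 1

  ι : ℕ → ℚ
  ι n = ιℤ (+ n)

  toℚᵘ-ιℤ : ∀ a → toℚᵘ (ιℤ a) ℚᵘ.≃ mkℚᵘ a 0
  toℚᵘ-ιℤ a = toℚᵘ-fromℚᵘ (mkℚᵘ a 0)

  ιℤ-+ : ∀ a b → ιℤ (a ℤ.+ b) ≡ ιℤ a + ιℤ b
  ιℤ-+ a b = toℚᵘ-injective (begin
    toℚᵘ (ιℤ (a ℤ.+ b))           ≈⟨ toℚᵘ-ιℤ (a ℤ.+ b) ⟩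
    mkℚᵘ (a ℤ.+ b) 0              ≈⟨ *≡* (cong₂ (λ x y → (x ℤ.+ y) ℤ.* + 1)
                                              (ℤ.*-identityʳ a) (ℤ.*-identityʳ b)) ⟨
    mkℚᵘ a 0 ℚᵘ.+ mkℚᵘ b 0        ≈⟨ ℚᵘ.+-cong (toℚᵘ-ιℤ a) (toℚᵘ-ιℤ b) ⟨
    toℚᵘ (ιℤ a) ℚᵘ.+ toℚᵘ (ιℤ b)  ≈⟨ toℚᵘ-homo-+ (ιℤ a) (ιℤ b) ⟨
    toℚᵘ (ιℤ a + ιℤ b)            ∎)
    where open ℚᵘ.≃-Reasoning

  ιℤ-* : ∀ a b → ιℤ (a ℤ.* b) ≡ ιℤ a * ιℤ b
  ιℤ-* a b = toℚᵘ-injective (begin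
    toℚᵘ (ιℤ (a ℤ.* b))           ≈⟨ toℚᵘ-ιℤ (a ℤ.* b) ⟩
    mkℚᵘ (a ℤ.* b) 0              ≈⟨ *≡* refl ⟩
    mkℚᵘ a 0 ℚᵘ.* mkℚᵘ b 0        ≈⟨ ℚᵘ.*-cong (toℚᵘ-ιℤ a) (toℚᵘ-ιℤ b) ⟨
    toℚᵘ (ιℤ a) ℚᵘ.* toℚᵘ (ιℤ b)  ≈⟨ toℚᵘ-homo-* (ιℤ a) (ιℤ b) ⟨
    toℚᵘ (ιℤ a * ιℤ b)            ∎)
    where open ℚᵘ.≃-Reasoning

  ι-+ : ∀ m n → ι (m ℕ.+ n) ≡ ι m + ι n
  ι-+ m n = trans (cong ιℤ (ℤ.pos-+ m n)) (ιℤ-+ (+ m) (+ n))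

  ι-* : ∀ m n → ι (m ℕ.* n) ≡ ι m * ι n
  ι-* m n = trans (cong ιℤ (ℤ.pos-* m n)) (ιℤ-* (+ m) (+ n))

  ι-2^-+ : ∀ m n → ι (2 ^ (m ℕ.+ n)) ≡ ι (2 ^ m) * ι (2 ^ n)
  ι-2^-+ m n = trans (cong ι (ℕ.^-distribˡ-+-* 2 m n)) (ι-* (2 ^ m) (2 ^ n))

  inv-inverseˡ : ∀ n → 0 < n → inv n * ι n ≡ 1ℚ
  inv-inverseˡ (suc m) _ = toℚᵘ-injective (begin
    toℚᵘ (inv (suc m) * ι (suc m))             ≈⟨ toℚᵘ-homo-* (inv (suc m)) (ι (suc m)) ⟩
    toℚᵘ (inv (suc m)) ℚᵘ.* toℚᵘ (ι (suc m))   ≈⟨ ℚᵘ.*-cong (toℚᵘ-fromℚᵘ (mkℚᵘ (+ 1) m)) (toℚᵘ-ιℤ (+ suc m)) ⟩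
    mkℚᵘ (+ 1) m ℚᵘ.* mkℚᵘ (+ suc m) 0        ≈⟨ *≡* (cong (λ x → + suc x) m+0*1≡m*1+0) ⟩
    toℚᵘ 1ℚ                                    ∎)
    where
    open ℚᵘ.≃-Reasoning
    m+0*1≡m*1+0 : (m ℕ.+ 0) ℕ.* 1 ≡ m ℕ.* 1 ℕ.+ 0
    m+0*1≡m*1+0 = trans (cong (ℕ._* 1) (ℕ.+-identityʳ m)) (sym (ℕ.+-identityʳ (m ℕ.* 1)))

  inv-inverseʳ : ∀ n → 0 < n → ι n * inv n ≡ 1ℚ
  inv-inverseʳ n n>0 = trans (*-comm (ι n) (inv n)) (inv-inverseˡ n n>0)

  *-cancelˡ-invertible : ∀ {u v p q} → u * v ≡ 1ℚ → v * p ≡ v * q → p ≡ q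
  *-cancelˡ-invertible {u} {v} {p} {q} uv≡1 vp≡vq = begin
    p            ≡⟨ *-identityˡ p ⟨
    1ℚ * p       ≡⟨ cong (_* p) uv≡1 ⟨
    u * v * p    ≡⟨ *-assoc u v p ⟩
    u * (v * p)  ≡⟨ cong (u *_) vp≡vq ⟩
    u * (v * q)  ≡⟨ *-assoc u v q ⟨
    u * v * q    ≡⟨ cong (_* q) uv≡1 ⟩
    1ℚ * q       ≡⟨ *-identityˡ q ⟩
    q            ∎
    where open ≡-Reasoning

  ι-cancelˡ : ∀ n {p q} → 0 < n → ι n * p ≡ ι n * q → p ≡ q
  ι-cancelˡ n n>0 = *-cancelˡ-invertible {inv n} {ι n} (inv-inverseˡ n n>0)

  inv≡ι*inv : ∀ {m n p} → 0 < m → 0 < n → m ℕ.* n ≡ p → inv m ≡ ι n * inv p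
  inv≡ι*inv {m@(suc _)} {n@(suc _)} _ _ refl = ι-cancelˡ (m ℕ.* n) (s≤s z≤n) (begin
    ι (m ℕ.* n) * inv m                  ≡⟨ cong (_* inv m) (ι-* m n) ⟩
    ι m * ι n * inv m                    ≡⟨ xy∙z≈y∙xz (ι m) (ι n) (inv m) ⟩
    ι n * (ι m * inv m)                  ≡⟨ cong (ι n *_) (inv-inverseʳ m (s≤s z≤n)) ⟩
    ι n * 1ℚ                             ≡⟨ cong (ι n *_) (inv-inverseʳ (m ℕ.* n) (s≤s z≤n)) ⟨
    ι n * (ι (m ℕ.* n) * inv (m ℕ.* n))  ≡⟨ x∙yz≈y∙xz (ι n) (ι (m ℕ.* n)) (inv (m ℕ.* n)) ⟩
    ι (m ℕ.* n) * (ι n * inv (m ℕ.* n))  ∎)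
    where open ≡-Reasoning

  ιℤ*inv≡/ : ∀ a b → ιℤ a * inv (suc b) ≡ a / suc b
  ιℤ*inv≡/ a b = toℚᵘ-injective (begin
    toℚᵘ (ιℤ a * inv (suc b))               ≈⟨ toℚᵘ-homo-* (ιℤ a) (inv (suc b)) ⟩
    toℚᵘ (ιℤ a) ℚᵘ.* toℚᵘ (inv (suc b))     ≈⟨ ℚᵘ.*-cong (toℚᵘ-ιℤ a) (toℚᵘ-fromℚᵘ (mkℚᵘ (+ 1) b)) ⟩
    mkℚᵘ a 0 ℚᵘ.* mkℚᵘ (+ 1) b             ≈⟨ *≡* (trans (cong (ℤ._* + suc b) (ℤ.*-identityʳ a))
                                                          (cong (λ c → a ℤ.* + suc c) (sym (ℕ.+-identityʳ b)))) ⟩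
    mkℚᵘ a b                                ≈⟨ toℚᵘ-fromℚᵘ (mkℚᵘ a b) ⟨
    toℚᵘ (a / suc b)                        ∎)
    where open ℚᵘ.≃-Reasoning

module Valuation where
  open import Data.Nat as ℕ using (ℕ; zero; suc; _^_; _≤_; _∸_; s≤s; z≤n)
  import Data.Nat.Properties as ℕ
  open import Data.Nat.Divisibility using (divides)
  open import Data.Integer as ℤ using (ℤ; +_; +[1+_]; -[1+_]; 0ℤ)
  import Data.Integer.Properties as ℤ
  open import Data.Rational using (ℚ; 0ℚ; 1ℚ; _+_; _*_; -_; _/_)
  open import Data.Rational.Properties
    using (*-comm; *-assoc; *-identityˡ; *-identityʳ; *-zeroʳ; neg-distribˡ-*; *-1-commutativeMonoid)
  open import Algebra.Bundles using (CommutativeMonoid)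
  open import Algebra.Properties.CommutativeSemigroup (CommutativeMonoid.commutativeSemigroup *-1-commutativeMonoid)
  open import Data.Product using (∃₂; _×_; _,_)
  open import Data.Sum using (inj₁; inj₂)
  open import Relation.Nullary using (yes; no; contradiction)
  open import Relation.Binary.PropositionalEquality
  open import Tactic.RingSolver using (solve-∀)
  open Parity
  open Embedding

  infix 4 _≤ν₂_

  -- m ≤ν₂ q says q ∈ 2^m ℤ₍₂₎, witnessed by q d = 2^m a with d odd. Unlike ν₂≥ it needs
  -- no reduced fraction, so it is closed under the ring operations.
  record _≤ν₂_ (m : ℕ) (q : ℚ) : Set where
    constructor ≤ν₂-witness
    field
      numerator       : ℤ
      denominator     : ℕ
      odd-denominator : OddNat denominator
      equation        : q * ι denominator ≡ ι (2 ^ m) * ιℤ numerator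

  ≤ν₂-weaken : ∀ {m n q} → n ≤ m → m ≤ν₂ q → n ≤ν₂ q
  ≤ν₂-weaken {m} {n} {q} n≤m (≤ν₂-witness a d odd-d eq) =
    ≤ν₂-witness (+ (2 ^ (m ∸ n)) ℤ.* a) d odd-d (begin
    q * ι d                                 ≡⟨ eq ⟩
    ι (2 ^ m) * ιℤ a                        ≡⟨ cong (λ k → ι (2 ^ k) * ιℤ a) (ℕ.m+[n∸m]≡n n≤m) ⟨
    ι (2 ^ (n ℕ.+ (m ∸ n))) * ιℤ a          ≡⟨ cong (_* ιℤ a) (ι-2^-+ n (m ∸ n)) ⟩
    ι (2 ^ n) * ι (2 ^ (m ∸ n)) * ιℤ a      ≡⟨ *-assoc (ι (2 ^ n)) _ _ ⟩
    ι (2 ^ n) * (ι (2 ^ (m ∸ n)) * ιℤ a)    ≡⟨ cong (ι (2 ^ n) *_) (ιℤ-* (+ (2 ^ (m ∸ n))) a) ⟨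
    ι (2 ^ n) * ιℤ (+ (2 ^ (m ∸ n)) ℤ.* a)  ∎)
    where open ≡-Reasoning

  ≤ν₂-+ : ∀ {m p q} → m ≤ν₂ p → m ≤ν₂ q → m ≤ν₂ (p + q)
  ≤ν₂-+ {m} {p} {q} (≤ν₂-witness a d odd-d eq) (≤ν₂-witness a′ d′ odd-d′ eq′) =
    ≤ν₂-witness (a ℤ.* + d′ ℤ.+ a′ ℤ.* + d) (d ℕ.* d′) (odd-* odd-d odd-d′) (begin
      (p + q) * ι (d ℕ.* d′)                           ≡⟨ cong ((p + q) *_) (ι-* d d′) ⟩
      (p + q) * (ι d * ι d′)                           ≡⟨ spread p q (ι d) (ι d′) ⟩
      (p * ι d) * ι d′ + (q * ι d′) * ι d              ≡⟨ cong₂ (λ x y → x * ι d′ + y * ι d) eq eq′ ⟩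
      (P * ιℤ a) * ι d′ + (P * ιℤ a′) * ι d            ≡⟨ factor P (ιℤ a) (ιℤ a′) (ι d) (ι d′) ⟩
      P * (ιℤ a * ι d′ + ιℤ a′ * ι d)                  ≡⟨ cong (P *_) (cong₂ _+_ (ιℤ-* a (+ d′)) (ιℤ-* a′ (+ d))) ⟨
      P * (ιℤ (a ℤ.* + d′) + ιℤ (a′ ℤ.* + d))          ≡⟨ cong (P *_) (ιℤ-+ (a ℤ.* + d′) (a′ ℤ.* + d)) ⟨
      P * ιℤ (a ℤ.* + d′ ℤ.+ a′ ℤ.* + d)               ∎)
    where
    open ≡-Reasoning
    P = ι (2 ^ m)
    spread : ∀ p q x y → (p + q) * (x * y) ≡ (p * x) * y + (q * y) * x
    spread = solve-∀ ringℚ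
    factor : ∀ P a a′ x y → (P * a) * y + (P * a′) * x ≡ P * (a * y + a′ * x)
    factor = solve-∀ ringℚ

  ≤ν₂-* : ∀ {m n p q} → m ≤ν₂ p → n ≤ν₂ q → (m ℕ.+ n) ≤ν₂ (p * q)
  ≤ν₂-* {m} {n} {p} {q} (≤ν₂-witness a d odd-d eq) (≤ν₂-witness a′ d′ odd-d′ eq′) =
    ≤ν₂-witness (a ℤ.* a′) (d ℕ.* d′) (odd-* odd-d odd-d′) (begin
      (p * q) * ι (d ℕ.* d′)                       ≡⟨ cong ((p * q) *_) (ι-* d d′) ⟩
      (p * q) * (ι d * ι d′)                       ≡⟨ interchange p q (ι d) (ι d′) ⟩
      (p * ι d) * (q * ι d′)                       ≡⟨ cong₂ _*_ eq eq′ ⟩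
      (ι (2 ^ m) * ιℤ a) * (ι (2 ^ n) * ιℤ a′)     ≡⟨ interchange (ι (2 ^ m)) (ιℤ a) (ι (2 ^ n)) (ιℤ a′) ⟩
      (ι (2 ^ m) * ι (2 ^ n)) * (ιℤ a * ιℤ a′)     ≡⟨ cong₂ _*_ (ι-2^-+ m n) (ιℤ-* a a′) ⟨
      ι (2 ^ (m ℕ.+ n)) * ιℤ (a ℤ.* a′)            ∎)
    where open ≡-Reasoning

  ≤ν₂-neg : ∀ {m q} → m ≤ν₂ q → m ≤ν₂ (- q)
  ≤ν₂-neg {m} {q} m≤ν₂q =
    subst (m ≤ν₂_) (trans (sym (neg-distribˡ-* 1ℚ q)) (cong -_ (*-identityˡ q))) (≤ν₂-* 0≤ν₂-1 m≤ν₂q)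
    where
    0≤ν₂-1 : 0 ≤ν₂ - 1ℚ
    0≤ν₂-1 = ≤ν₂-witness -[1+ 0 ] 1 odd-1 refl

  ≤ν₂-sumTo : ∀ {m} n g → (∀ k → k ≤ n → m ≤ν₂ g k) → m ≤ν₂ sumTo n g
  ≤ν₂-sumTo zero    g m≤ν₂g = m≤ν₂g 0 z≤n
  ≤ν₂-sumTo (suc n) g m≤ν₂g =
    ≤ν₂-+ (≤ν₂-sumTo n g (λ k k≤n → m≤ν₂g k (ℕ.m≤n⇒m≤1+n k≤n))) (m≤ν₂g (suc n) ℕ.≤-refl)

  m≤ν₂2^m : ∀ m → m ≤ν₂ ι (2 ^ m)
  m≤ν₂2^m m = ≤ν₂-witness (+ 1) 1 odd-1 refl

  0≤ν₂inv : ∀ {d} → OddNat d → 0 ≤ν₂ inv d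
  0≤ν₂inv {d} odd-d = ≤ν₂-witness (+ 1) d odd-d (inv-inverseˡ d (odd⇒>0 odd-d))

  ≤ν₂-cancel-odd : ∀ {m d q} → OddNat d → m ≤ν₂ (ι d * q) → m ≤ν₂ q
  ≤ν₂-cancel-odd {m} {d} {q} odd-d (≤ν₂-witness a b odd-b eq) =
    ≤ν₂-witness a (d ℕ.* b) (odd-* odd-d odd-b) (begin
      q * ι (d ℕ.* b)      ≡⟨ cong (q *_) (ι-* d b) ⟩
      q * (ι d * ι b)      ≡⟨ x∙yz≈yx∙z q (ι d) (ι b) ⟩
      ι d * q * ι b        ≡⟨ eq ⟩
      ι (2 ^ m) * ιℤ a     ∎)
    where open ≡-Reasoning

  ≤ν₂-cancel-2^ : ∀ t {m q} → (t ℕ.+ m) ≤ν₂ (ι (2 ^ t) * q) → m ≤ν₂ q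
  ≤ν₂-cancel-2^ t {m} {q} (≤ν₂-witness a b odd-b eq) =
    ≤ν₂-witness a b odd-b (ι-cancelˡ (2 ^ t) (ℕ.m^n>0 2 t) (begin
      ι (2 ^ t) * (q * ι b)                ≡⟨ *-assoc (ι (2 ^ t)) q (ι b) ⟨
      ι (2 ^ t) * q * ι b                  ≡⟨ eq ⟩
      ι (2 ^ (t ℕ.+ m)) * ιℤ a             ≡⟨ cong (_* ιℤ a) (ι-2^-+ t m) ⟩
      ι (2 ^ t) * ι (2 ^ m) * ιℤ a         ≡⟨ *-assoc (ι (2 ^ t)) (ι (2 ^ m)) (ιℤ a) ⟩
      ι (2 ^ t) * (ι (2 ^ m) * ιℤ a)       ∎))
    where open ≡-Reasoning

  ≤ν₂-÷2^ : ∀ t {m k q r} → t ℕ.+ m ≤ k → k ≤ν₂ r → r ≡ ι (2 ^ t) * q → m ≤ν₂ q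
  ≤ν₂-÷2^ t {k = k} t+m≤k k≤ν₂r r≡2^t*q =
    ≤ν₂-cancel-2^ t (≤ν₂-weaken t+m≤k (subst (k ≤ν₂_) r≡2^t*q k≤ν₂r))

  odd-part-ℤ : ∀ a → a ≢ 0ℤ → ∃₂ λ r a′ → OddInt a′ × a ≡ + (2 ^ r) ℤ.* a′
  odd-part-ℤ (+ zero)  a≢0 = contradiction refl a≢0
  odd-part-ℤ +[1+ k ] _ with odd-part (suc k) (s≤s z≤n)
  ... | r , u , odd-u , 1+k≡2^r*u = r , + u , odd-u , trans (cong +_ 1+k≡2^r*u) (ℤ.pos-* (2 ^ r) u)
  odd-part-ℤ -[1+ k ] _ with odd-part (suc k) (s≤s z≤n)
  ... | r , u , odd-u , 1+k≡2^r*u = r , ℤ.- + u , subst OddNat (sym (ℤ.∣-i∣≡∣i∣ (+ u))) odd-u , (begin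
    ℤ.- + suc k                   ≡⟨ cong (λ n → ℤ.- + n) 1+k≡2^r*u ⟩
    ℤ.- + (2 ^ r ℕ.* u)           ≡⟨ cong ℤ.-_ (ℤ.pos-* (2 ^ r) u) ⟩
    ℤ.- (+ (2 ^ r) ℤ.* + u)       ≡⟨ ℤ.neg-distribʳ-* (+ (2 ^ r)) (+ u) ⟩
    + (2 ^ r) ℤ.* ℤ.- + u         ∎)
    where open ≡-Reasoning

  ≤ν₂⇒ν₂≥ : ∀ {m q} → m ≤ν₂ q → ν₂≥ q m
  ≤ν₂⇒ν₂≥ (≤ν₂-witness _ zero odd-0 _) = contradiction (divides 0 refl) odd-0
  ≤ν₂⇒ν₂≥ {m} {q} (≤ν₂-witness a (suc b) odd-d eq) with a ℤ.≟ 0ℤ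
  ... | yes refl = inj₁ (ι-cancelˡ (suc b) (s≤s z≤n) (begin
    ι (suc b) * q             ≡⟨ *-comm (ι (suc b)) q ⟩
    q * ι (suc b)             ≡⟨ eq ⟩
    ι (2 ^ m) * 0ℚ            ≡⟨ *-zeroʳ (ι (2 ^ m)) ⟩
    0ℚ                        ≡⟨ *-zeroʳ (ι (suc b)) ⟨
    ι (suc b) * 0ℚ            ∎))
    where open ≡-Reasoning
  ... | no a≢0 with odd-part-ℤ a a≢0
  ...   | r , a′ , odd-a′ , a≡2^r*a′ = inj₂ (m ℕ.+ r , a′ , b , ℕ.m≤m+n m r , odd-a′ , odd-d , (begin
    q                                       ≡⟨ ι-cancelˡ (suc b) (s≤s z≤n) ιq≡ιX*inv ⟩
    ιℤ X * inv (suc b)                      ≡⟨ ιℤ*inv≡/ X b ⟩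
    X / suc b                               ≡⟨ cong (_/ suc b) X≡2^[m+r]*a′ ⟩
    (+ (2 ^ (m ℕ.+ r)) ℤ.* a′) / suc b      ∎))
    where
    open ≡-Reasoning
    X = + (2 ^ m) ℤ.* a
    ιq≡ιX*inv : ι (suc b) * q ≡ ι (suc b) * (ιℤ X * inv (suc b))
    ιq≡ιX*inv = begin
      ι (suc b) * q                       ≡⟨ *-comm (ι (suc b)) q ⟩
      q * ι (suc b)                       ≡⟨ eq ⟩
      ι (2 ^ m) * ιℤ a                    ≡⟨ ιℤ-* (+ (2 ^ m)) a ⟨
      ιℤ X                                ≡⟨ *-identityʳ (ιℤ X) ⟨
      ιℤ X * 1ℚ                           ≡⟨ cong (ιℤ X *_) (inv-inverseʳ (suc b) (s≤s z≤n)) ⟨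
      ιℤ X * (ι (suc b) * inv (suc b))    ≡⟨ x∙yz≈y∙xz (ιℤ X) (ι (suc b)) (inv (suc b)) ⟩
      ι (suc b) * (ιℤ X * inv (suc b))    ∎
    X≡2^[m+r]*a′ : X ≡ + (2 ^ (m ℕ.+ r)) ℤ.* a′
    X≡2^[m+r]*a′ = begin
      + (2 ^ m) ℤ.* a                       ≡⟨ cong (+ (2 ^ m) ℤ.*_) a≡2^r*a′ ⟩
      + (2 ^ m) ℤ.* (+ (2 ^ r) ℤ.* a′)      ≡⟨ ℤ.*-assoc (+ (2 ^ m)) (+ (2 ^ r)) a′ ⟨
      + (2 ^ m) ℤ.* + (2 ^ r) ℤ.* a′        ≡⟨ cong (ℤ._* a′) (ℤ.pos-* (2 ^ m) (2 ^ r)) ⟨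
      + (2 ^ m ℕ.* 2 ^ r) ℤ.* a′            ≡⟨ cong (λ n → + n ℤ.* a′) (ℕ.^-distribˡ-+-* 2 m r) ⟨
      + (2 ^ (m ℕ.+ r)) ℤ.* a′              ∎

module Sums where
  open import Data.Nat as ℕ using (ℕ; zero; suc; _≤_; z≤n)
  import Data.Nat.Properties as ℕ
  open import Data.Rational using (ℚ; _+_; _*_; _-_; -_)
  open import Data.Rational.Properties using (+-assoc; *-distribˡ-+; neg-distribˡ-*; +-0-commutativeMonoid)
  open import Algebra.Bundles using (CommutativeMonoid)
  open import Algebra.Properties.CommutativeSemigroup (CommutativeMonoid.commutativeSemigroup +-0-commutativeMonoid)
    using (interchange)
  open import Relation.Binary.PropositionalEquality

  sumTo-cong : ∀ n {g h : ℕ → ℚ} → (∀ k → k ≤ n → g k ≡ h k) → sumTo n g ≡ sumTo n h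
  sumTo-cong zero    g≗h = g≗h 0 z≤n
  sumTo-cong (suc n) g≗h =
    cong₂ _+_ (sumTo-cong n (λ k k≤n → g≗h k (ℕ.m≤n⇒m≤1+n k≤n))) (g≗h (suc n) ℕ.≤-refl)

  sumTo-*ˡ : ∀ n c (g : ℕ → ℚ) → sumTo n (λ k → c * g k) ≡ c * sumTo n g
  sumTo-*ˡ zero    c g = refl
  sumTo-*ˡ (suc n) c g = trans (cong (_+ c * g (suc n)) (sumTo-*ˡ n c g)) (sym (*-distribˡ-+ c _ _))

  sumTo-+ : ∀ n (g h : ℕ → ℚ) → sumTo n (λ k → g k + h k) ≡ sumTo n g + sumTo n h
  sumTo-+ zero    g h = refl
  sumTo-+ (suc n) g h = trans (cong (_+ (g (suc n) + h (suc n))) (sumTo-+ n g h))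
                              (interchange (sumTo n g) (sumTo n h) (g (suc n)) (h (suc n)))

  sumTo-linear : ∀ n c (g h : ℕ → ℚ) → sumTo n (λ k → g k - c * h k) ≡ sumTo n g - c * sumTo n h
  sumTo-linear n c g h = begin
    sumTo n (λ k → g k - c * h k)          ≡⟨ sumTo-+ n g (λ k → - (c * h k)) ⟩
    sumTo n g + sumTo n (λ k → - (c * h k)) ≡⟨ cong (sumTo n g +_) (sumTo-cong n (λ k _ → neg-distribˡ-* c (h k))) ⟩
    sumTo n g + sumTo n (λ k → (- c) * h k) ≡⟨ cong (sumTo n g +_) (sumTo-*ˡ n (- c) h) ⟩
    sumTo n g + (- c) * sumTo n h           ≡⟨ cong (sumTo n g +_) (neg-distribˡ-* c (sumTo n h)) ⟨
    sumTo n g - c * sumTo n h               ∎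
    where open ≡-Reasoning

  sumTo-suc : ∀ n (g : ℕ → ℚ) → sumTo (suc n) g ≡ g 0 + sumTo n (λ k → g (suc k))
  sumTo-suc zero    g = refl
  sumTo-suc (suc n) g = trans (cong (_+ g (suc (suc n))) (sumTo-suc n g)) (+-assoc (g 0) _ _)

  sumTo-split : ∀ n m (g : ℕ → ℚ) → sumTo (suc n ℕ.+ m) g ≡ sumTo m g + sumTo n (λ j → g (suc j ℕ.+ m))
  sumTo-split zero    m g = refl
  sumTo-split (suc n) m g =
    trans (cong (_+ g (suc (suc n ℕ.+ m))) (sumTo-split n m g)) (+-assoc (sumTo m g) _ _)

module ReciprocalBinomialSum where
  open import Data.Nat as ℕ using (ℕ; zero; suc; _^_; _≤_; _∸_; s≤s; z≤n)
  import Data.Nat.Properties as ℕ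
  open import Data.Nat.Combinatorics using (_C_; nCn≡1)
  open import Data.Rational using (ℚ; 1ℚ; _+_; _*_)
  open import Relation.Binary.PropositionalEquality
  open import Tactic.RingSolver using (solve-∀)
  open Binomial
  open Embedding
  open Sums

  reciprocal-pascal : ∀ n k → k ≤ n →
                      ι (2 ℕ.+ n) * inv (n C k) ≡ ι (suc n) * (inv (suc n C k) + inv (suc n C suc k))
  reciprocal-pascal n k k≤n = begin
    ι (2 ℕ.+ n) * inv (n C k)                           ≡⟨ cong (ι (2 ℕ.+ n) *_) inv[nCk] ⟩
    ι (2 ℕ.+ n) * (ι (suc n) * I)                       ≡⟨ cong (λ x → ι x * (ι (suc n) * I)) 2+n≡[1+n∸k]+[1+k] ⟩
    ι ((suc n ∸ k) ℕ.+ suc k) * (ι (suc n) * I)         ≡⟨ cong (_* (ι (suc n) * I)) (ι-+ (suc n ∸ k) (suc k)) ⟩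
    (ι (suc n ∸ k) + ι (suc k)) * (ι (suc n) * I)       ≡⟨ rearrange (ι (suc n ∸ k)) (ι (suc k)) (ι (suc n)) I ⟩
    ι (suc n) * (ι (suc n ∸ k) * I + ι (suc k) * I)     ≡⟨ cong (ι (suc n) *_) (cong₂ _+_ inv[1+nCk] inv[1+nC1+k]) ⟨
    ι (suc n) * (inv (suc n C k) + inv (suc n C suc k)) ∎
    where
    open ≡-Reasoning
    I = inv (suc n ℕ.* (n C k))
    inv[nCk] : inv (n C k) ≡ ι (suc n) * I
    inv[nCk] = inv≡ι*inv (nCk>0 k≤n) (s≤s z≤n) (ℕ.*-comm (n C k) (suc n))
    inv[1+nCk] : inv (suc n C k) ≡ ι (suc n ∸ k) * I
    inv[1+nCk] = inv≡ι*inv (nCk>0 (ℕ.m≤n⇒m≤1+n k≤n)) (ℕ.m<n⇒0<n∸m (s≤s k≤n))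
                   (trans (ℕ.*-comm (suc n C k) (suc n ∸ k)) ([1+n∸k]*[1+n]Ck≡[1+n]*nCk n k k≤n))
    inv[1+nC1+k] : inv (suc n C suc k) ≡ ι (suc k) * I
    inv[1+nC1+k] = inv≡ι*inv (nCk>0 (s≤s k≤n)) (s≤s z≤n)
                     (trans (ℕ.*-comm (suc n C suc k) (suc k)) ([1+k]*[1+n]C[1+k]≡[1+n]*nCk n k))
    2+n≡[1+n∸k]+[1+k] : 2 ℕ.+ n ≡ (suc n ∸ k) ℕ.+ suc k
    2+n≡[1+n∸k]+[1+k] = sym (trans (ℕ.+-suc (suc n ∸ k) k) (cong suc (ℕ.m∸n+n≡m (ℕ.m≤n⇒m≤1+n k≤n))))
    rearrange : ∀ a b s i → (a + b) * (s * i) ≡ s * (a * i + b * i)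
    rearrange = solve-∀ ringℚ

  f-recurrence : ∀ n → ι (suc n) * (f (suc n) + f (suc n)) ≡ ι (2 ℕ.+ n) * f n + (ι (suc n) + ι (suc n))
  f-recurrence n = begin
    ι (suc n) * (f (suc n) + f (suc n))         ≡⟨ cong₂ (λ x y → ι (suc n) * (x + y)) f[1+n]≡A+1 f[1+n]≡1+B ⟩
    ι (suc n) * ((A + 1ℚ) + (1ℚ + B))           ≡⟨ rearrange (ι (suc n)) A B ⟩
    ι (suc n) * (A + B) + (ι (suc n) + ι (suc n)) ≡⟨ cong (_+ (ι (suc n) + ι (suc n))) [2+n]f[n]≡[1+n][A+B] ⟨
    ι (2 ℕ.+ n) * f n + (ι (suc n) + ι (suc n)) ∎
    where
    open ≡-Reasoning
    A = sumTo n (λ k → inv (suc n C k))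
    B = sumTo n (λ k → inv (suc n C suc k))
    f[1+n]≡A+1 : f (suc n) ≡ A + 1ℚ
    f[1+n]≡A+1 = cong (λ c → A + inv c) (nCn≡1 (suc n))
    f[1+n]≡1+B : f (suc n) ≡ 1ℚ + B
    f[1+n]≡1+B = sumTo-suc n (λ k → inv (suc n C k))
    [2+n]f[n]≡[1+n][A+B] : ι (2 ℕ.+ n) * f n ≡ ι (suc n) * (A + B)
    [2+n]f[n]≡[1+n][A+B] = begin
      ι (2 ℕ.+ n) * f n                                              ≡⟨ sumTo-*ˡ n (ι (2 ℕ.+ n)) _ ⟨
      sumTo n (λ k → ι (2 ℕ.+ n) * inv (n C k))                      ≡⟨ sumTo-cong n (reciprocal-pascal n) ⟩
      sumTo n (λ k → ι (suc n) * (inv (suc n C k) + inv (suc n C suc k))) ≡⟨ sumTo-*ˡ n (ι (suc n)) _ ⟩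
      ι (suc n) * sumTo n (λ k → inv (suc n C k) + inv (suc n C suc k))  ≡⟨ cong (ι (suc n) *_) (sumTo-+ n _ _) ⟩
      ι (suc n) * (A + B)                                            ∎
    rearrange : ∀ s a b → s * ((a + 1ℚ) + (1ℚ + b)) ≡ s * (a + b) + (s + s)
    rearrange = solve-∀ ringℚ

  2^k/k : ℕ → ℚ
  2^k/k k = ι (2 ^ k) * inv k

  -- The k = 0 term vanishes (inv 0 = 0), so H₂ M = Σ_{k=1}^{M} 2^k / k.
  H₂ : ℕ → ℚ
  H₂ M = sumTo M 2^k/k

  ι-2^suc : ∀ m → ι (2 ^ suc m) ≡ ι (2 ^ m) + ι (2 ^ m)
  ι-2^suc m = trans (cong (λ x → ι (2 ^ m ℕ.+ x)) (ℕ.+-identityʳ (2 ^ m))) (ι-+ (2 ^ m) (2 ^ m))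

  f-closed-form : ∀ n → ι (2 ^ suc n) * f n ≡ ι (suc n) * H₂ (suc n)
  f-closed-form zero    = refl
  f-closed-form (suc n) = ι-cancelˡ (suc n) (s≤s z≤n) (begin
    s * (ι (2 ^ (2 ℕ.+ n)) * F)                     ≡⟨ cong (λ x → s * (x * F)) (ι-2^suc (suc n)) ⟩
    s * ((P + P) * F)                               ≡⟨ rearrange₁ s P F ⟩
    P * (s * (F + F))                               ≡⟨ cong (P *_) (f-recurrence n) ⟩
    P * (t * f n + (s + s))                         ≡⟨ rearrange₂ P t (f n) s ⟩
    t * (P * f n) + s * (P + P)                     ≡⟨ cong (λ x → t * x + s * (P + P)) (f-closed-form n) ⟩
    t * (s * H) + s * (P + P)                       ≡⟨ rearrange₃ t s H (P + P) ⟩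
    s * (t * H + (P + P) * 1ℚ)                      ≡⟨ cong (λ x → s * (t * H + (P + P) * x)) (inv-inverseʳ (2 ℕ.+ n) (s≤s z≤n)) ⟨
    s * (t * H + (P + P) * (t * inv (2 ℕ.+ n)))     ≡⟨ cong (s *_) (rearrange₄ t H (P + P) (inv (2 ℕ.+ n))) ⟩
    s * (t * (H + (P + P) * inv (2 ℕ.+ n)))         ≡⟨ cong (λ x → s * (t * (H + x * inv (2 ℕ.+ n)))) (ι-2^suc (suc n)) ⟨
    s * (t * H₂ (2 ℕ.+ n))                          ∎)
    where
    open ≡-Reasoning
    s = ι (suc n)
    t = ι (2 ℕ.+ n)
    P = ι (2 ^ suc n)
    F = f (suc n)
    H = H₂ (suc n)
    rearrange₁ : ∀ s P F → s * ((P + P) * F) ≡ P * (s * (F + F))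
    rearrange₁ = solve-∀ ringℚ
    rearrange₂ : ∀ P t x s → P * (t * x + (s + s)) ≡ t * (P * x) + s * (P + P)
    rearrange₂ = solve-∀ ringℚ
    rearrange₃ : ∀ t s H Q → t * (s * H) + s * Q ≡ s * (t * H + Q * 1ℚ)
    rearrange₃ = solve-∀ ringℚ
    rearrange₄ : ∀ t H Q i → t * H + Q * (t * i) ≡ t * (H + Q * i)
    rearrange₄ = solve-∀ ringℚ

module Doubling where
  open import Data.Nat as ℕ using (ℕ; suc; _^_; _<_)
  import Data.Nat.Properties as ℕ
  open import Data.Rational using (ℚ; 1ℚ; _+_; _*_; _-_; -_)
  open import Data.Rational.Properties using (+-identityˡ; *-assoc)
  open import Relation.Binary.PropositionalEquality
  open import Tactic.RingSolver using (solve-∀)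
  open Embedding
  open Sums
  open ReciprocalBinomialSum

  δ : ℕ → ℕ → ℚ
  δ N J = 2^k/k (J ℕ.+ N) - ι (2 ^ N) * 2^k/k J

  H₂-doubling : ∀ n → H₂ (suc n ℕ.+ suc n) ≡
                      (1ℚ + ι (2 ^ suc n)) * H₂ (suc n) + sumTo n (λ j → δ (suc n) (suc j))
  H₂-doubling n = begin
    H₂ (N ℕ.+ N)                            ≡⟨ sumTo-split n N 2^k/k ⟩
    H₂ N + U                                ≡⟨ rearrange (H₂ N) U P ⟩
    (1ℚ + P) * H₂ N + (U - P * H₂ N)        ≡⟨ cong (λ x → (1ℚ + P) * H₂ N + (U - P * x)) H₂[N]≡S ⟩
    (1ℚ + P) * H₂ N + (U - P * S)           ≡⟨ cong ((1ℚ + P) * H₂ N +_) (sumTo-linear n P _ _) ⟨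
    (1ℚ + P) * H₂ N + sumTo n (λ j → δ N (suc j)) ∎
    where
    open ≡-Reasoning
    N = suc n
    P = ι (2 ^ N)
    U = sumTo n (λ j → 2^k/k (suc j ℕ.+ N))
    S = sumTo n (λ j → 2^k/k (suc j))
    H₂[N]≡S : H₂ N ≡ S
    H₂[N]≡S = trans (sumTo-suc n 2^k/k) (+-identityˡ S)
    rearrange : ∀ h u p → h + u ≡ (1ℚ + p) * h + (u - p * h)
    rearrange = solve-∀ ringℚ

  δ-equation : ∀ N J → 0 < J → δ N J * ι (J ℕ.* (J ℕ.+ N)) ≡ - (ι (2 ^ (J ℕ.+ N)) * ι N)
  δ-equation N J J>0 = begin
    δ N J * ι (J ℕ.* (J ℕ.+ N))                         ≡⟨ cong₂ (λ x y → (Q * inv (J ℕ.+ N) - x) * y)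
                                                                 2^N*2^k/k[J]≡Q*inv[J] (ι-* J (J ℕ.+ N)) ⟩
    (Q * inv (J ℕ.+ N) - Q * inv J) * (ι J * ι (J ℕ.+ N)) ≡⟨ expand Q (inv (J ℕ.+ N)) (inv J) (ι J) (ι (J ℕ.+ N)) ⟩
    Q * (inv (J ℕ.+ N) * ι (J ℕ.+ N)) * ι J - Q * (inv J * ι J) * ι (J ℕ.+ N)
                                                        ≡⟨ cong₂ (λ x y → Q * x * ι J - Q * y * ι (J ℕ.+ N))
                                                                 (inv-inverseˡ (J ℕ.+ N) (ℕ.<-≤-trans J>0 (ℕ.m≤m+n J N)))
                                                                 (inv-inverseˡ J J>0) ⟩
    Q * 1ℚ * ι J - Q * 1ℚ * ι (J ℕ.+ N)                 ≡⟨ cong (λ x → Q * 1ℚ * ι J - Q * 1ℚ * x) (ι-+ J N) ⟩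
    Q * 1ℚ * ι J - Q * 1ℚ * (ι J + ι N)                 ≡⟨ collapse Q (ι J) (ι N) ⟩
    - (Q * ι N)                                         ∎
    where
    open ≡-Reasoning
    Q = ι (2 ^ (J ℕ.+ N))
    2^N*2^k/k[J]≡Q*inv[J] : ι (2 ^ N) * 2^k/k J ≡ Q * inv J
    2^N*2^k/k[J]≡Q*inv[J] = begin
      ι (2 ^ N) * (ι (2 ^ J) * inv J)    ≡⟨ *-assoc (ι (2 ^ N)) (ι (2 ^ J)) (inv J) ⟨
      ι (2 ^ N) * ι (2 ^ J) * inv J      ≡⟨ cong (_* inv J) (ι-2^-+ N J) ⟨
      ι (2 ^ (N ℕ.+ J)) * inv J          ≡⟨ cong (λ k → ι (2 ^ k) * inv J) (ℕ.+-comm N J) ⟩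
      Q * inv J                          ∎
    expand : ∀ Q x y a b → (Q * x - Q * y) * (a * b) ≡ Q * (x * b) * a - Q * (y * a) * b
    expand = solve-∀ ringℚ
    collapse : ∀ Q a n → Q * 1ℚ * a - Q * 1ℚ * (a + n) ≡ - (Q * n)
    collapse = solve-∀ ringℚ

module Mersenne where
  open import Data.Nat as ℕ using (suc; _^_; _≤_; _<_; s≤s; z≤n)
  import Data.Nat.Properties as ℕ
  open import Data.Product using (_,_)
  open import Data.Rational using (1ℚ; _+_; _*_; _-_; -_)
  open import Relation.Binary.PropositionalEquality
  open import Data.List using (_∷_; [])
  open import Tactic.RingSolver using (solve-∀)
  import Data.Nat.Tactic.RingSolver as ℕ-Solver
  open import Data.Rational.Properties using (*-1-commutativeMonoid)
  open import Algebra.Bundles using (CommutativeMonoid)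
  open import Algebra.Properties.CommutativeSemigroup (CommutativeMonoid.commutativeSemigroup *-1-commutativeMonoid)
    using (x∙yz≈y∙zx)
  open Parity
  open Binomial
  open Embedding
  open Valuation
  open ReciprocalBinomialSum
  open Doubling

  0≤ν₂f[2^e∸1] : ∀ e {n} → suc n ≡ 2 ^ e → 0 ≤ν₂ f n
  0≤ν₂f[2^e∸1] e {n} 1+n≡2^e = ≤ν₂-sumTo n _ (λ k k≤n → 0≤ν₂inv (odd-mersenne-nCk e 1+n≡2^e k≤n))

  N+e≤ν₂H₂[N+N] : ∀ {e n} → 3 ≤ e → suc n ≡ 2 ^ e → (suc n ℕ.+ e) ≤ν₂ H₂ (suc n ℕ.+ suc n)
  N+e≤ν₂H₂[N+N] {e} {n} 3≤e 1+n≡2^e = ≤ν₂-÷2^ (suc e) bound 2N≤ν₂2^[2N]*f[2N∸1] closed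
    where
    open ℕ.≤-Reasoning
    N = suc n
    2N≡2^[1+e] : N ℕ.+ N ≡ 2 ^ suc e
    2N≡2^[1+e] = cong₂ ℕ._+_ 1+n≡2^e (trans 1+n≡2^e (sym (ℕ.+-identityʳ (2 ^ e))))
    2N≤ν₂2^[2N]*f[2N∸1] : N ℕ.+ N ℕ.+ 0 ≤ν₂ ι (2 ^ (N ℕ.+ N)) * f (n ℕ.+ N)
    2N≤ν₂2^[2N]*f[2N∸1] = ≤ν₂-* (m≤ν₂2^m (N ℕ.+ N)) (0≤ν₂f[2^e∸1] (suc e) 2N≡2^[1+e])
    closed : ι (2 ^ (N ℕ.+ N)) * f (n ℕ.+ N) ≡ ι (2 ^ suc e) * H₂ (N ℕ.+ N)
    closed = trans (f-closed-form (n ℕ.+ N)) (cong (λ x → ι x * H₂ (N ℕ.+ N)) 2N≡2^[1+e])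
    bound : suc e ℕ.+ (N ℕ.+ e) ≤ N ℕ.+ N ℕ.+ 0
    bound = begin
      suc e ℕ.+ (suc n ℕ.+ e)   ≡⟨ ℕ-Solver.solve (e ∷ n ∷ []) ⟩
      suc n ℕ.+ suc (e ℕ.+ e)   ≤⟨ ℕ.+-monoʳ-≤ N (subst (suc (e ℕ.+ e) ≤_) (sym 1+n≡2^e) (2e+1≤2^e e 3≤e)) ⟩
      N ℕ.+ N                   ≡⟨ ℕ.+-identityʳ (N ℕ.+ N) ⟨
      N ℕ.+ N ℕ.+ 0             ∎

  N+e≤ν₂δ : ∀ {e n J} → 3 ≤ e → suc n ≡ 2 ^ e → 0 < J → J ≤ suc n → (suc n ℕ.+ e) ≤ν₂ δ (suc n) J
  N+e≤ν₂δ {e} {n} {J} 3≤e 1+n≡2^e J>0 J≤N with odd-part-J*[J+2^e] e J 3≤e J>0 (subst (J ≤_) 1+n≡2^e J≤N)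
  ... | t , d , odd-d , t≤J , J[J+2^e]≡2^t*d =
    ≤ν₂-cancel-odd odd-d (≤ν₂-÷2^ t bound (≤ν₂-neg (≤ν₂-* (m≤ν₂2^m (J ℕ.+ N)) (m≤ν₂2^m e))) rearranged)
    where
    N = suc n
    rearranged : - (ι (2 ^ (J ℕ.+ N)) * ι (2 ^ e)) ≡ ι (2 ^ t) * (ι d * δ N J)
    rearranged = begin
      - (ι (2 ^ (J ℕ.+ N)) * ι (2 ^ e))   ≡⟨ cong (λ x → - (ι (2 ^ (J ℕ.+ N)) * ι x)) 1+n≡2^e ⟨
      - (ι (2 ^ (J ℕ.+ N)) * ι N)         ≡⟨ δ-equation N J J>0 ⟨
      δ N J * ι (J ℕ.* (J ℕ.+ N))         ≡⟨ cong (λ x → δ N J * ι (J ℕ.* (J ℕ.+ x))) 1+n≡2^e ⟩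
      δ N J * ι (J ℕ.* (J ℕ.+ 2 ^ e))     ≡⟨ cong (λ x → δ N J * ι x) J[J+2^e]≡2^t*d ⟩
      δ N J * ι (2 ^ t ℕ.* d)             ≡⟨ cong (δ N J *_) (ι-* (2 ^ t) d) ⟩
      δ N J * (ι (2 ^ t) * ι d)           ≡⟨ x∙yz≈y∙zx (δ N J) (ι (2 ^ t)) (ι d) ⟩
      ι (2 ^ t) * (ι d * δ N J)           ∎
      where open ≡-Reasoning
    bound : t ℕ.+ (N ℕ.+ e) ≤ J ℕ.+ N ℕ.+ e
    bound = ℕ.≤-trans (ℕ.+-monoˡ-≤ (N ℕ.+ e) t≤J) (ℕ.≤-reflexive (sym (ℕ.+-assoc J N e)))

  N+e≤ν₂H₂[N] : ∀ {e n} → 3 ≤ e → suc n ≡ 2 ^ e → (suc n ℕ.+ e) ≤ν₂ H₂ (suc n)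
  N+e≤ν₂H₂[N] {e} {n} 3≤e 1+n≡2^e =
    ≤ν₂-cancel-odd (odd-1+2* (2 ^ n)) (subst (N ℕ.+ e ≤ν₂_) H₂[N+N]-E≡[1+2^N]*H₂[N]
      (≤ν₂-+ (N+e≤ν₂H₂[N+N] 3≤e 1+n≡2^e) (≤ν₂-neg N+e≤ν₂E)))
    where
    N = suc n
    E = sumTo n (λ j → δ N (suc j))
    N+e≤ν₂E : N ℕ.+ e ≤ν₂ E
    N+e≤ν₂E = ≤ν₂-sumTo n _ (λ j j≤n → N+e≤ν₂δ 3≤e 1+n≡2^e (s≤s z≤n) (s≤s j≤n))
    H₂[N+N]-E≡[1+2^N]*H₂[N] : H₂ (N ℕ.+ N) - E ≡ ι (1 ℕ.+ 2 ^ N) * H₂ N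
    H₂[N+N]-E≡[1+2^N]*H₂[N] = begin
      H₂ (N ℕ.+ N) - E                         ≡⟨ cong (_- E) (H₂-doubling n) ⟩
      (1ℚ + ι (2 ^ N)) * H₂ N + E - E          ≡⟨ cancel ((1ℚ + ι (2 ^ N)) * H₂ N) E ⟩
      (1ℚ + ι (2 ^ N)) * H₂ N                  ≡⟨ cong (_* H₂ N) (ι-+ 1 (2 ^ N)) ⟨
      ι (1 ℕ.+ 2 ^ N) * H₂ N                   ∎
      where
      open ≡-Reasoning
      cancel : ∀ x y → x + y - y ≡ x
      cancel = solve-∀ ringℚ

  2e≤ν₂f[2^e∸1] : ∀ {e n} → 3 ≤ e → suc n ≡ 2 ^ e → (2 ℕ.* e) ≤ν₂ f n
  2e≤ν₂f[2^e∸1] {e} {n} 3≤e 1+n≡2^e =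
    ≤ν₂-÷2^ (suc n) bound (≤ν₂-* (m≤ν₂2^m e) (N+e≤ν₂H₂[N] 3≤e 1+n≡2^e)) closed
    where
    closed : ι (2 ^ e) * H₂ (suc n) ≡ ι (2 ^ suc n) * f n
    closed = trans (cong (λ x → ι x * H₂ (suc n)) (sym 1+n≡2^e)) (sym (f-closed-form n))
    bound : suc n ℕ.+ 2 ℕ.* e ≤ e ℕ.+ (suc n ℕ.+ e)
    bound = ℕ.≤-reflexive (ℕ-Solver.solve (n ∷ e ∷ []))

open import Data.Nat using (ℕ; _≤_; _∸_; _^_; _*_)
open import Data.Nat.Properties using (m+[n∸m]≡n; m^n>0)
open Valuation using (≤ν₂⇒ν₂≥)
open Mersenne using (2e≤ν₂f[2^e∸1])

proposition4p3 : (e : ℕ) → 3 ≤ e → ν₂≥ (f (2 ^ e ∸ 1)) (2 * e)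
proposition4p3 e 3≤e = ≤ν₂⇒ν₂≥ (2e≤ν₂f[2^e∸1] 3≤e (m+[n∸m]≡n (m^n>0 2 e)))
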